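{- Let $(X,\sigma,\tau)$ be a solution. Then $\sigma_{\hat\sigma_x(y)}=\sigma_y$ for all $x,y\in X$ if and only if $\sigma_{\tau_x(y)}=\sigma_y$ for all $x,y\in X$.
   Context: A solution is a triple $(X,\sigma,\tau)$ with $X$ a non-empty set and bijections $\sigma_x,\tau_y$ of $X$ such that $r(x,y)=(\sigma_x(y),\tau_y(x))$ is a bijection of $X^2$ satisfying $(\mathrm{id}\times r)(r\times\mathrm{id})(\mathrm{id}\times r)=(r\times\mathrm{id})(\mathrm{id}\times r)(r\times\mathrm{id})$. The maps $\hat\sigma_x,\hat\tau_y$ are defined by $r^{ -1}(x,y)=(\hat\sigma_x(y),\hat\tau_y(x))$. -}

module Defs where

open import Level using (Level)
open import Data.Product using (_×_; _,_; proj₁; proj₂)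
open import Relation.Binary.PropositionalEquality using (_≡_)
open import Function.Bundles using (_↔_; Inverse)

-- The map r(x,y) = (σ_x(y), τ_y(x)) attached to σ, τ : X → X → X
-- (σ x is σ_x, τ y is τ_y).
rmap : {ℓ : Level} {X : Set ℓ} → (X → X → X) → (X → X → X) → X × X → X × X
rmap σ τ (x , y) = (σ x y , τ y x)

_×id : {ℓ : Level} {X : Set ℓ} → (X × X → X × X) → X × X × X → X × X × X
(f ×id) (x , y , z) = (proj₁ (f (x , y)) , proj₂ (f (x , y)) , z)

id×_ : {ℓ : Level} {X : Set ℓ} → (X × X → X × X) → X × X × X → X × X × X
(id× f) (x , y , z) = (x , proj₁ (f (y , z)) , proj₂ (f (y , z)))

record Solution {ℓ : Level} (X : Set ℓ) : Set ℓ where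
  field
    σ : X → X → X
    τ : X → X → X
    nonempty : X
    σ-bij : (x : X) → X ↔ X
    σ-bij-fun : (x y : X) → Inverse.to (σ-bij x) y ≡ σ x y
    τ-bij : (y : X) → X ↔ X
    τ-bij-fun : (y x : X) → Inverse.to (τ-bij y) x ≡ τ y x
    r-bij : (X × X) ↔ (X × X)
    r-bij-fun : (p : X × X) → Inverse.to r-bij p ≡ rmap σ τ p
    braid : (t : X × X × X) →
      (id× rmap σ τ) ((rmap σ τ ×id) ((id× rmap σ τ) t))
        ≡ (rmap σ τ ×id) ((id× rmap σ τ) ((rmap σ τ ×id) t))

  r : X × X → X × X
  r = rmap σ τ

  r⁻¹ : X × X → X × X
  r⁻¹ = Inverse.from r-bij

  σ̂ : X → X → X
  σ̂ x y = proj₁ (r⁻¹ (x , y))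

  τ̂ : X → X → X
  τ̂ y x = proj₂ (r⁻¹ (x , y))

{-# OPTIONS --safe #-}
module Submission where

open import Defs
open import Level using (Level)
open import Data.Product using (_×_; _,_; proj₁; proj₂)
open import Relation.Binary.PropositionalEquality using (_≡_; sym; trans; cong)
open import Function.Bundles using (Inverse)

-- Reading
-- r⁻¹ ∘ r = id and r ∘ r⁻¹ = id componentwise gives
--   σ̂_{σ_y(x)}(τ_x(y)) = y   and   τ_{τ̂_y(x)}(σ̂_x(y)) = y,
-- so applying σ and either hypothesis turns it into the other one.

module _ {ℓ : Level} {X : Set ℓ} (S : Solution X) where
  open Solution S

  σ-invariant-under : (X → X → X) → Set ℓ
  σ-invariant-under f = ∀ x y → σ (f x y) ≡ σ y

  r⁻¹∘r : ∀ p → r⁻¹ (r p) ≡ p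
  r⁻¹∘r p = trans (cong r⁻¹ (sym (r-bij-fun p))) (Inverse.strictlyInverseʳ r-bij p)

  r∘r⁻¹ : ∀ p → r (r⁻¹ p) ≡ p
  r∘r⁻¹ p = trans (sym (r-bij-fun (r⁻¹ p))) (Inverse.strictlyInverseˡ r-bij p)

  σ̂-σ-τ : ∀ x y → σ̂ (σ y x) (τ x y) ≡ y
  σ̂-σ-τ x y = cong proj₁ (r⁻¹∘r (y , x))

  τ-τ̂-σ̂ : ∀ x y → τ (τ̂ y x) (σ̂ x y) ≡ y
  τ-τ̂-σ̂ x y = cong proj₂ (r∘r⁻¹ (x , y))

  σ-invariant-σ̂⇒τ : σ-invariant-under σ̂ → σ-invariant-under τ
  σ-invariant-σ̂⇒τ inv x y =
    trans (sym (inv (σ y x) (τ x y))) (cong σ (σ̂-σ-τ x y))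

  σ-invariant-τ⇒σ̂ : σ-invariant-under τ → σ-invariant-under σ̂
  σ-invariant-τ⇒σ̂ inv x y =
    trans (sym (inv (τ̂ y x) (σ̂ x y))) (cong σ (τ-τ̂-σ̂ x y))

proposition4p14 : {ℓ : Level} {X : Set ℓ} (S : Solution X) →
    let open Solution S in
    ((∀ (x y : X) → σ (σ̂ x y) ≡ σ y) → (∀ (x y : X) → σ (τ x y) ≡ σ y))
    × ((∀ (x y : X) → σ (τ x y) ≡ σ y) → (∀ (x y : X) → σ (σ̂ x y) ≡ σ y))
proposition4p14 S = σ-invariant-σ̂⇒τ S , σ-invariant-τ⇒σ̂ S
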